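{- Let $r:X\looparrowright Y$ be a weakening relation between posets, with graph $X\xleftarrow{p}R\xrightarrow{q}Y$ (where $R=\{(x,y)\mid xry\}\subseteq X\times Y$ with the product order and $p,q$ the projections). Let $\mathbbm{2}^X$ denote the poset of monotone maps $X\to\mathbbm{2}$ (identified with up-sets of $X$, ordered by inclusion), and $\mathbbm{2}^p:\mathbbm{2}^X\to\mathbbm{2}^R$, $\mathbbm{2}^q:\mathbbm{2}^Y\to\mathbbm{2}^R$ the maps given by precomposition. Define $\overline{\mathbbm{2}}(r)=(\mathbbm{2}^q)^\ast\cdot(\mathbbm{2}^p)_\ast:\mathbbm{2}^X\looparrowright\mathbbm{2}^Y$. Then for all up-sets $A\in\mathbbm{2}^X$, $B\in\mathbbm{2}^Y$: $(A,B)\in\overline{\mathbbm{2}}(r)$ if and only if $r[A]\subseteq B$, where $r[A]=\{b\mid \exists a\in A.\ a\,r\,b\}$.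
   Context: $\mathbbm{2}=\{0<1\}$. A weakening relation $R:A\looparrowright B$ between posets is a subset $R\subseteq A\times B$ with $a'\le a\,R\,b\le b'\Rightarrow a'Rb'$. Composition $S\cdot R$ means first $R$, then $S$ (ordinary relational composition). For a monotone map $f:A\to B$, $f_\ast:A\looparrowright B$ is $\{(a,b)\mid f(a)\le b\}$ and $f^\ast:B\looparrowright A$ is $\{(b,a)\mid b\le f(a)\}$. -}

module Defs where

open import Level using (Level; _⊔_; suc)
open import Data.Bool using (Bool; true; false)
import Data.Bool as B
import Data.Bool.Properties as BP
open import Data.Product using (Σ; Σ-syntax; ∃; ∃-syntax; _×_; _,_; proj₁; proj₂)
open import Relation.Binary using (Poset; IsPartialOrder; IsPreorder; IsEquivalence; Rel)
open import Relation.Binary.PropositionalEquality using (_≡_; refl; sym; trans; cong)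

private variable
  c ℓ₁ ℓ₂ c' ℓ₁' ℓ₂' c'' ℓ₁'' ℓ₂'' ℓ ℓ' : Level

record Mono (X : Poset c ℓ₁ ℓ₂) (Y : Poset c' ℓ₁' ℓ₂') : Set (c ⊔ ℓ₂ ⊔ c' ⊔ ℓ₂') where
  constructor mono
  private
    module X = Poset X
    module Y = Poset Y
  field
    fun      : X.Carrier → Y.Carrier
    monotone : ∀ {x x'} → x X.≤ x' → fun x Y.≤ fun x'
open Mono public

record WRel (X : Poset c ℓ₁ ℓ₂) (Y : Poset c' ℓ₁' ℓ₂') (ℓ : Level)
       : Set (c ⊔ ℓ₂ ⊔ c' ⊔ ℓ₂' ⊔ suc ℓ) where
  constructor wrel
  private
    module X = Poset X
    module Y = Poset Y
  field
    rel  : X.Carrier → Y.Carrier → Set ℓ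
    weak : ∀ {x x' y y'} → x' X.≤ x → rel x y → y Y.≤ y' → rel x' y'
open WRel public

_·_ : {X : Poset c ℓ₁ ℓ₂} {Y : Poset c' ℓ₁' ℓ₂'} {Z : Poset c'' ℓ₁'' ℓ₂''} →
      WRel Y Z ℓ' → WRel X Y ℓ → WRel X Z (c' ⊔ ℓ ⊔ ℓ')
_·_ {X = X} {Y} {Z} S R = record
  { rel  = λ x z → ∃[ y ] (rel R x y × rel S y z)
  ; weak = λ x'≤x (y , xRy , ySz) z≤z' →
      y , weak R x'≤x xRy (Poset.refl Y) , weak S (Poset.refl Y) ySz z≤z' }

_₊ : {X : Poset c ℓ₁ ℓ₂} {Y : Poset c' ℓ₁' ℓ₂'} → Mono X Y → WRel X Y ℓ₂'
_₊ {X = X} {Y} f = record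
  { rel  = λ a b → fun f a Y.≤ b
  ; weak = λ a'≤a fa≤b b≤b' → Y.trans (monotone f a'≤a) (Y.trans fa≤b b≤b') }
  where module Y = Poset Y

_^* : {X : Poset c ℓ₁ ℓ₂} {Y : Poset c' ℓ₁' ℓ₂'} → Mono X Y → WRel Y X ℓ₂'
_^* {X = X} {Y} f = record
  { rel  = λ b a → b Y.≤ fun f a
  ; weak = λ b'≤b b≤fa a≤a' → Y.trans b'≤b (Y.trans b≤fa (monotone f a≤a')) }
  where module Y = Poset Y

𝟚 : Poset _ _ _
𝟚 = BP.≤-poset

𝟚^ : Poset c ℓ₁ ℓ₂ → Poset (c ⊔ ℓ₂) c c
𝟚^ X = record
  { Carrier = Mono X 𝟚
  ; _≈_ = λ A B → ∀ x → fun A x ≡ fun B x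
  ; _≤_ = λ A B → ∀ x → fun A x B.≤ fun B x
  ; isPartialOrder = record
    { isPreorder = record
      { isEquivalence = record
        { refl = λ x → refl ; sym = λ p x → sym (p x) ; trans = λ p q x → trans (p x) (q x) }
      ; reflexive = λ p x → BP.≤-reflexive (p x)
      ; trans = λ p q x → BP.≤-trans (p x) (q x) }
    ; antisym = λ p q x → BP.≤-antisym (p x) (q x) } }

Graph : {X : Poset c ℓ₁ ℓ₂} {Y : Poset c' ℓ₁' ℓ₂'} → WRel X Y ℓ → Poset (c ⊔ c' ⊔ ℓ) (ℓ₁ ⊔ ℓ₁') (ℓ₂ ⊔ ℓ₂')
Graph {X = X} {Y} r = record
  { Carrier = Σ[ xy ∈ X.Carrier × Y.Carrier ] rel r (proj₁ xy) (proj₂ xy)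
  ; _≈_ = λ u v → (proj₁ (proj₁ u) X.≈ proj₁ (proj₁ v)) × (proj₂ (proj₁ u) Y.≈ proj₂ (proj₁ v))
  ; _≤_ = λ u v → (proj₁ (proj₁ u) X.≤ proj₁ (proj₁ v)) × (proj₂ (proj₁ u) Y.≤ proj₂ (proj₁ v))
  ; isPartialOrder = record
    { isPreorder = record
      { isEquivalence = record
        { refl = X.Eq.refl , Y.Eq.refl
        ; sym = λ (p , q) → X.Eq.sym p , Y.Eq.sym q
        ; trans = λ (p , q) (p' , q') → X.Eq.trans p p' , Y.Eq.trans q q' }
      ; reflexive = λ (p , q) → X.reflexive p , Y.reflexive q
      ; trans = λ (p , q) (p' , q') → X.trans p p' , Y.trans q q' }
    ; antisym = λ (p , q) (p' , q') → X.antisym p p' , Y.antisym q q' } }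
  where
  module X = Poset X
  module Y = Poset Y

projX : {X : Poset c ℓ₁ ℓ₂} {Y : Poset c' ℓ₁' ℓ₂'} (r : WRel X Y ℓ) → Mono (Graph r) X
projX r = mono (λ u → proj₁ (proj₁ u)) proj₁

projY : {X : Poset c ℓ₁ ℓ₂} {Y : Poset c' ℓ₁' ℓ₂'} (r : WRel X Y ℓ) → Mono (Graph r) Y
projY r = mono (λ u → proj₂ (proj₁ u)) proj₂

𝟚^map : {A : Poset c ℓ₁ ℓ₂} {B : Poset c' ℓ₁' ℓ₂'} → Mono A B → Mono (𝟚^ B) (𝟚^ A)
𝟚^map f = mono (λ U → mono (λ a → fun U (fun f a)) (λ a≤a' → monotone U (monotone f a≤a')))
               (λ U≤V a → U≤V (fun f a))

𝟚bar : {X : Poset c ℓ₁ ℓ₂} {Y : Poset c' ℓ₁' ℓ₂'} (r : WRel X Y ℓ) → WRel (𝟚^ X) (𝟚^ Y) _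
𝟚bar r = (𝟚^map (projY r) ^*) · (𝟚^map (projX r) ₊)

_∈↑_ : {X : Poset c ℓ₁ ℓ₂} → Poset.Carrier X → Mono X 𝟚 → Set
x ∈↑ A = fun A x ≡ true

image⊆ : {X : Poset c ℓ₁ ℓ₂} {Y : Poset c' ℓ₁' ℓ₂'} (r : WRel X Y ℓ) →
         Mono X 𝟚 → Mono Y 𝟚 → Set (c ⊔ c' ⊔ ℓ)
image⊆ {X = X} {Y} r A B =
  ∀ (b : Poset.Carrier Y) → (∃[ a ] (_∈↑_ {X = X} a A × rel r a b)) → _∈↑_ {X = Y} b B

-- A composite f^* · g_* relates x to y exactly when g x ≤ f y (take g x itself as the
-- middle point).  Hence A 2̄(r) B says A ∘ p ≤ B ∘ q in 2^R, i.e. A a ≤ B b whenever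
-- a r b; in 2 the order is implication of truth, so this is r[A] ⊆ B.
module Submission where

open import Defs
open import Level using (Level)
open import Relation.Binary using (Poset)
open import Function.Bundles using (_⇔_; mk⇔; Equivalence)
open import Function.Construct.Composition using (_⇔-∘_)
open import Data.Bool using (Bool; true; false; _≤_; b≤b; f≤t)
open import Data.Product using (_,_)
open import Relation.Binary.PropositionalEquality using (_≡_; refl)

private variable
  c ℓ₁ ℓ₂ c' ℓ₁' ℓ₂' c'' ℓ₁'' ℓ₂'' ℓ : Level

≤⇔≡true⇒≡true : ∀ {x y : Bool} → x ≤ y ⇔ (x ≡ true → y ≡ true)
≤⇔≡true⇒≡true = mk⇔ to from
  where
  to : ∀ {x y} → x ≤ y → x ≡ true → y ≡ true
  to b≤b refl = refl
  from : ∀ {x y} → (x ≡ true → y ≡ true) → x ≤ y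
  from {false} {false} _ = b≤b
  from {false} {true}  _ = f≤t
  from {true}          h with h refl
  ... | refl = b≤b

conjoint·companion⇔≤ : {X : Poset c ℓ₁ ℓ₂} {Y : Poset c' ℓ₁' ℓ₂'} {Z : Poset c'' ℓ₁'' ℓ₂''}
  (f : Mono Y Z) (g : Mono X Z) (x : Poset.Carrier X) (y : Poset.Carrier Y) →
  rel ((f ^*) · (g ₊)) x y ⇔ Poset._≤_ Z (fun g x) (fun f y)
conjoint·companion⇔≤ {Z = Z} f g x y =
  mk⇔ (λ (_ , gx≤z , z≤fy) → Z.trans gx≤z z≤fy) (λ gx≤fy → fun g x , Z.refl , gx≤fy)
  where module Z = Poset Z

𝟚^-≤-on-graph⇔image⊆ : {X : Poset c ℓ₁ ℓ₂} {Y : Poset c' ℓ₁' ℓ₂'}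
  (r : WRel X Y ℓ) (A : Mono X 𝟚) (B : Mono Y 𝟚) →
  Poset._≤_ (𝟚^ (Graph r)) (fun (𝟚^map (projX r)) A) (fun (𝟚^map (projY r)) B)
    ⇔ image⊆ r A B
𝟚^-≤-on-graph⇔image⊆ r A B = mk⇔
  (λ A∘p≤B∘q b (a , a∈A , arb) → Equivalence.to ≤⇔≡true⇒≡true (A∘p≤B∘q ((a , b) , arb)) a∈A)
  (λ img ((a , b) , arb) → Equivalence.from ≤⇔≡true⇒≡true (λ a∈A → img b (a , a∈A , arb)))

proposition4p2 : ∀ {c ℓ₁ ℓ₂ c' ℓ₁' ℓ₂' ℓ} {X : Poset c ℓ₁ ℓ₂} {Y : Poset c' ℓ₁' ℓ₂'}
    (r : WRel X Y ℓ) (A : Mono X 𝟚) (B : Mono Y 𝟚) →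
    rel (𝟚bar r) A B ⇔ image⊆ r A B
proposition4p2 r A B =
  𝟚^-≤-on-graph⇔image⊆ r A B
    ⇔-∘ conjoint·companion⇔≤ (𝟚^map (projY r)) (𝟚^map (projX r)) A B
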